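{- Let $A$ be an alphabet with $q\geq 4$ letters, and for $n\geq 1$ let $M_q(n)=q^{ -n}\sum_{w\in A^n}P(w)$, where $P(w)$ is the number of distinct nonempty palindromes occurring as factors of $w$. Then $$\limsup_{n\to\infty}\frac{M_q(n)}{n}<1.$$
   Context: $A^n$ is the set of words of length $n$ over $A$. A word is a palindrome if it equals its reversal; a factor is a block of consecutive letters of a word. -}

module Defs where

open import Data.Nat using (ℕ; zero; suc; _+_; _*_; _^_)
open import Data.Fin using (Fin)
import Data.Fin.Properties as FinP
open import Data.List using (List; []; _∷_; [_]; map; concatMap; _++_; reverse; filter; deduplicate; length; allFin)
open import Data.Nat.ListAction using (sum)
open import Data.List.Properties using (≡-dec)
open import Relation.Binary.PropositionalEquality using (_≡_)
open import Relation.Nullary using (Dec)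

Word : ℕ → Set
Word q = List (Fin q)

words : (q n : ℕ) → List (Word q)
words q zero = [ [] ]
words q (suc n) = concatMap (λ w → map (λ a → a ∷ w) (allFin q)) (words q n)

nePrefixes : ∀ {q} → Word q → List (Word q)
nePrefixes [] = []
nePrefixes (x ∷ xs) = [ x ] ∷ map (x ∷_) (nePrefixes xs)

-- All nonempty factors (with repetition, by occurrence).
factors : ∀ {q} → Word q → List (Word q)
factors [] = []
factors (x ∷ xs) = nePrefixes (x ∷ xs) ++ factors xs

IsPalindrome : ∀ {q} → Word q → Set
IsPalindrome w = reverse w ≡ w

isPalindrome? : ∀ {q} (w : Word q) → Dec (IsPalindrome w)
isPalindrome? w = ≡-dec FinP._≟_ (reverse w) w

_≟W_ : ∀ {q} (u v : Word q) → Dec (u ≡ v)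
_≟W_ = ≡-dec FinP._≟_

P : ∀ {q} → Word q → ℕ
P w = length (deduplicate _≟W_ (filter isPalindrome? (factors w)))

-- S_q(n) = Σ_{w ∈ A^n} P(w) = q^n · M_q(n).
S : (q n : ℕ) → ℕ
S q n = sum (map P (words q n))

module Submission where

-- A palindrome of length ≤ 1 is one of the q + 1 words of
-- length ≤ 1, and each distinct palindrome of length ≥ 2 in w occurs in w.
-- Hence P(w) ≤ (q + 1) + O(w), where O(w) counts the occurrences of
-- palindromes of length ≥ 2 in w (the "long palindromes").  Let O(n) and
-- E(n) be the totals over A^n of such occurrences and of such prefixes.
-- Splitting off the first, resp. last, letter gives
--   O(n+1) = E(n+1) + q·O(n),    E(n+1) ≤ q·E(n) + #palindromes in A^(n+1),
-- and there are at most q^⌈m/2⌉ palindromes of length m.  Summing this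
-- geometric series gives (q-1)·E(n) ≤ 2·q^n, hence (q-1)·O(n) ≤ 2·n·q^n and
--   S q n ≤ (q+1)·q^n + 2·n·q^n/(q-1),
-- so that M_q(n)/n ≤ 3/4 once q ≥ 4 and n ≥ 12(q+1).

open import Defs
open import Data.Nat using (ℕ; _*_; _^_; _≤_; _<_)
open import Data.Product using (Σ; _×_)

open import Data.Nat using (zero; suc; _+_; z≤n; s≤s; z<s; _≤?_; ⌈_/2⌉)
open import Data.Nat.Properties
open import Data.Nat.Tactic.RingSolver using (solve-∀)
open import Data.Fin using (Fin)
import Data.Fin.Properties as Fin
open import Data.List
  using (List; []; _∷_; [_]; map; concatMap; _++_; filter; length; allFin; reverse; deduplicate; _∷ʳ_)
open import Data.List.Properties
  using (map-++; length-++; filter-++; length-map; length-tabulate; length-removeAt′; ∷-injective; ∷ʳ-injective; unfold-reverse; reverse-++)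
open import Data.Nat.ListAction using (sum)
open import Data.Nat.ListAction.Properties using (sum-++)
open import Data.List.Membership.Propositional using (_∈_)
open import Data.List.Membership.Propositional.Properties using (∈-allFin; ∈-map⁺; ∈-++⁺ˡ; ∈-++⁺ʳ; ∈-filter⁺; ∈-filter⁻; ∈-deduplicate⁻)
open import Data.List.Relation.Binary.Subset.Propositional using (_⊆_)
open import Data.List.Relation.Unary.Any using (here; there; index; _─_)
open import Data.List.Relation.Unary.All using (All; []; _∷_)
import Data.List.Relation.Unary.All as All
open import Data.List.Relation.Unary.Unique.Propositional using (Unique; []; _∷_)
open import Data.List.Relation.Unary.Unique.Propositional.Properties using (allFin⁺)
open import Data.List.Relation.Unary.Unique.DecPropositional.Properties using (deduplicate-!)
open import Data.Product using (_,_; proj₁; proj₂)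
open import Data.Empty using (⊥-elim)
open import Relation.Binary.Definitions using (DecidableEquality)
open import Relation.Binary.PropositionalEquality using (_≡_; _≢_; refl; sym; trans; cong; cong₂; subst; module ≡-Reasoning)
open import Relation.Nullary using (yes; no; ¬_; _×-dec_)
open import Relation.Unary using (Pred; Decidable)
open import Level using (0ℓ)

module Sums where

  private variable A B : Set

  Σ⟨_⟩_ : List A → (A → ℕ) → ℕ
  Σ⟨ xs ⟩ f = sum (map f xs)

  infix 8 Σ⟨_⟩_

  Σ-mono : ∀ (xs : List A) {f g : A → ℕ} → (∀ x → f x ≤ g x) → Σ⟨ xs ⟩ f ≤ Σ⟨ xs ⟩ g
  Σ-mono []       f≤g = z≤n
  Σ-mono (x ∷ xs) f≤g = +-mono-≤ (f≤g x) (Σ-mono xs f≤g)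

  Σ-cong : ∀ (xs : List A) {f g : A → ℕ} → (∀ x → f x ≡ g x) → Σ⟨ xs ⟩ f ≡ Σ⟨ xs ⟩ g
  Σ-cong []       f≡g = refl
  Σ-cong (x ∷ xs) f≡g = cong₂ _+_ (f≡g x) (Σ-cong xs f≡g)

  Σ-+ : ∀ (xs : List A) (f g : A → ℕ) → Σ⟨ xs ⟩ (λ x → f x + g x) ≡ Σ⟨ xs ⟩ f + Σ⟨ xs ⟩ g
  Σ-+ []       f g = refl
  Σ-+ (x ∷ xs) f g = trans (cong (f x + g x +_) (Σ-+ xs f g)) (interchange (f x) (g x) _ _)
    where
    interchange : ∀ a b c d → a + b + (c + d) ≡ a + c + (b + d)
    interchange = solve-∀

  Σ-* : ∀ (xs : List A) (c : ℕ) (f : A → ℕ) → Σ⟨ xs ⟩ (λ x → c * f x) ≡ c * Σ⟨ xs ⟩ f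
  Σ-* []       c f = sym (*-zeroʳ c)
  Σ-* (x ∷ xs) c f = trans (cong (c * f x +_) (Σ-* xs c f)) (sym (*-distribˡ-+ c (f x) _))

  Σ-const : ∀ (xs : List A) (c : ℕ) → Σ⟨ xs ⟩ (λ _ → c) ≡ c * length xs
  Σ-const []       c = sym (*-zeroʳ c)
  Σ-const (x ∷ xs) c = trans (cong (c +_) (Σ-const xs c)) (sym (*-suc c (length xs)))

  Σ-vanish : ∀ {xs : List A} {f} → All (λ x → f x ≡ 0) xs → Σ⟨ xs ⟩ f ≡ 0
  Σ-vanish []         = refl
  Σ-vanish (fx≡0 ∷ z) = cong₂ _+_ fx≡0 (Σ-vanish z)

  Σ-++ : ∀ (xs : List A) ys (f : A → ℕ) → Σ⟨ xs ++ ys ⟩ f ≡ Σ⟨ xs ⟩ f + Σ⟨ ys ⟩ f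
  Σ-++ xs ys f = trans (cong sum (map-++ f xs ys)) (sum-++ (map f xs) (map f ys))

  Σ-map : ∀ (xs : List A) (g : A → B) (f : B → ℕ) → Σ⟨ map g xs ⟩ f ≡ Σ⟨ xs ⟩ (λ x → f (g x))
  Σ-map []       g f = refl
  Σ-map (x ∷ xs) g f = cong (f (g x) +_) (Σ-map xs g f)

  Σ-concatMap : ∀ (xs : List A) (g : A → List B) (f : B → ℕ) →
    Σ⟨ concatMap g xs ⟩ f ≡ Σ⟨ xs ⟩ (λ x → Σ⟨ g x ⟩ f)
  Σ-concatMap []       g f = refl
  Σ-concatMap (x ∷ xs) g f =
    trans (Σ-++ (g x) (concatMap g xs) f) (cong (Σ⟨ g x ⟩ f +_) (Σ-concatMap xs g f))

  Σ-swap : ∀ (xs : List A) (ys : List B) (f : A → B → ℕ) →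
    Σ⟨ xs ⟩ (λ x → Σ⟨ ys ⟩ (f x)) ≡ Σ⟨ ys ⟩ (λ y → Σ⟨ xs ⟩ (λ x → f x y))
  Σ-swap []       ys f = sym (trans (Σ-const ys 0) (*-zeroˡ (length ys)))
  Σ-swap (x ∷ xs) ys f =
    trans (cong (Σ⟨ ys ⟩ (f x) +_) (Σ-swap xs ys f)) (sym (Σ-+ ys (f x) _))

  Σ-supported : DecidableEquality A → ∀ {xs} {f : A → ℕ} (a : A) →
    Unique xs → (∀ b → b ≢ a → f b ≡ 0) → Σ⟨ xs ⟩ f ≤ f a
  Σ-supported _≟_ a [] _ = z≤n
  Σ-supported _≟_ {x ∷ xs} {f} a (x∉xs ∷ u) off-a with x ≟ a
  ... | yes refl = ≤-reflexive (trans (cong (f x +_) rest≡0) (+-identityʳ (f x)))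
    where
    rest≡0 : Σ⟨ xs ⟩ f ≡ 0
    rest≡0 = Σ-vanish (All.map (λ {y} x≢y → off-a y (λ y≡x → x≢y (sym y≡x))) x∉xs)
  ... | no x≢a = subst (_≤ f a) (cong (_+ Σ⟨ xs ⟩ f) (sym (off-a x x≢a)))
                       (Σ-supported _≟_ a u off-a)

module Pigeonhole where

  private variable A : Set

  ∈-─ : ∀ {x y : A} {zs} (x∈zs : x ∈ zs) → y ∈ zs → x ≢ y → y ∈ (zs ─ x∈zs)
  ∈-─ (here refl) (here refl)  x≢y = ⊥-elim (x≢y refl)
  ∈-─ (here _)    (there y∈zs) _   = y∈zs
  ∈-─ (there _)   (here y≡z)   _   = here y≡z
  ∈-─ (there x∈zs) (there y∈zs) x≢y = there (∈-─ x∈zs y∈zs x≢y)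

  unique⊆⇒length≤ : ∀ {ys zs : List A} → Unique ys → ys ⊆ zs → length ys ≤ length zs
  unique⊆⇒length≤ []                 _ = z≤n
  unique⊆⇒length≤ {ys = x ∷ ys} {zs} (x∉ys ∷ u) ys⊆zs = begin
      suc (length ys)
    ≤⟨ s≤s (unique⊆⇒length≤ u (λ y∈ys → ∈-─ x∈zs (ys⊆zs (there y∈ys)) (All.lookup x∉ys y∈ys))) ⟩
      suc (length (zs ─ x∈zs))
    ≡⟨ sym (length-removeAt′ zs (index x∈zs)) ⟩
      length zs
    ∎
    where
    open ≤-Reasoning
    x∈zs = ys⊆zs (here refl)

module Counting {A : Set} where

  private variable
    R T : Pred A 0ℓ

  count : Decidable R → List A → ℕ
  count R? xs = length (filter R? xs)

  count-++ : (R? : Decidable R) (xs ys : List A) → count R? (xs ++ ys) ≡ count R? xs + count R? ys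
  count-++ R? xs ys = trans (cong length (filter-++ R? xs ys)) (length-++ (filter R? xs))

  𝟙 : Decidable R → A → ℕ
  𝟙 R? x = count R? [ x ]

  𝟙≤1 : (R? : Decidable R) (x : A) → 𝟙 R? x ≤ 1
  𝟙≤1 R? x with R? x
  ... | yes _ = s≤s z≤n
  ... | no  _ = z≤n

  𝟙-no : (R? : Decidable R) {x : A} → ¬ R x → 𝟙 R? x ≡ 0
  𝟙-no R? {x} ¬px with R? x
  ... | yes px = ⊥-elim (¬px px)
  ... | no  _  = refl

  𝟙-mono : (R? : Decidable R) (T? : Decidable T) {x y : A} → (R x → T y) → 𝟙 R? x ≤ 𝟙 T? y
  𝟙-mono R? T? {x} {y} R⇒T with R? x | T? y
  ... | no  _  | _      = z≤n
  ... | yes _  | yes _  = ≤-refl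
  ... | yes px | no ¬qy = ⊥-elim (¬qy (R⇒T px))

module Recurrences where

  -- Summing a geometric recurrence (ratio q = p + 1) against a slack
  -- sequence r: if each new term c n costs, after scaling by p, at most the
  -- loss q·r n - r (n+1) of slack, then p·e n + r n grows like q^n.
  geometric-slack : ∀ (p : ℕ) (e c r : ℕ → ℕ) →
    (∀ n → e (suc n) ≤ suc p * e n + c n) →
    (∀ n → p * c n + r (suc n) ≤ suc p * r n) →
    ∀ n → p * e n + r n ≤ (p * e 0 + r 0) * suc p ^ n
  geometric-slack p e c r e-step r-step zero = ≤-reflexive (sym (*-identityʳ _))
  geometric-slack p e c r e-step r-step (suc n) = begin
      p * e (suc n) + r (suc n)
    ≤⟨ +-monoˡ-≤ (r (suc n)) (*-monoʳ-≤ p (e-step n)) ⟩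
      p * (suc p * e n + c n) + r (suc n)
    ≡⟨ regroup p (e n) (c n) (r (suc n)) ⟩
      suc p * (p * e n) + (p * c n + r (suc n))
    ≤⟨ +-monoʳ-≤ (suc p * (p * e n)) (r-step n) ⟩
      suc p * (p * e n) + suc p * r n
    ≡⟨ sym (*-distribˡ-+ (suc p) (p * e n) (r n)) ⟩
      suc p * (p * e n + r n)
    ≤⟨ *-monoʳ-≤ (suc p) (geometric-slack p e c r e-step r-step n) ⟩
      suc p * (K * suc p ^ n)
    ≡⟨ *-comm (suc p) (K * suc p ^ n) ⟩
      K * suc p ^ n * suc p
    ≡⟨ *-assoc K (suc p ^ n) (suc p) ⟩
      K * (suc p ^ n * suc p)
    ≡⟨ cong (K *_) (*-comm (suc p ^ n) (suc p)) ⟩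
      K * suc p ^ suc n
    ∎
    where
    open ≤-Reasoning
    K = p * e 0 + r 0
    regroup : ∀ p x c r → p * (suc p * x + c) + r ≡ suc p * (p * x) + (p * c + r)
    regroup = solve-∀

  linear-accumulation : ∀ (q d c : ℕ) (o e : ℕ → ℕ) → o 0 ≡ 0 →
    (∀ n → o (suc n) ≤ e (suc n) + q * o n) →
    (∀ n → d * e (suc n) ≤ c * q ^ suc n) →
    ∀ n → d * o n ≤ c * (n * q ^ n)
  linear-accumulation q d c o e o₀≡0 o-step e-bound zero =
    ≤-trans (≤-reflexive (trans (cong (d *_) o₀≡0) (*-zeroʳ d))) z≤n
  linear-accumulation q d c o e o₀≡0 o-step e-bound (suc n) = begin
      d * o (suc n)
    ≤⟨ *-monoʳ-≤ d (o-step n) ⟩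
      d * (e (suc n) + q * o n)
    ≡⟨ regroup d (e (suc n)) q (o n) ⟩
      d * e (suc n) + q * (d * o n)
    ≤⟨ +-mono-≤ (e-bound n) (*-monoʳ-≤ q (linear-accumulation q d c o e o₀≡0 o-step e-bound n)) ⟩
      c * (q * q ^ n) + q * (c * (n * q ^ n))
    ≡⟨ collect c q (q ^ n) n ⟩
      c * (suc n * q ^ suc n)
    ∎
    where
    open ≤-Reasoning
    regroup : ∀ d e q o → d * (e + q * o) ≡ d * e + q * (d * o)
    regroup = solve-∀
    collect : ∀ c q x n → c * (q * x) + q * (c * (n * x)) ≡ c * (suc n * (q * x))
    collect = solve-∀

  -- The slack sequence for the series of the palindrome bounds q^⌈m/2⌉:
  -- slack q n = 2q^(k+1) for n = 2k and (q+1)q^(k+1) for n = 2k+1.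
  slack : ℕ → ℕ → ℕ
  slack q zero          = 2 * q
  slack q (suc zero)    = q * suc q
  slack q (suc (suc n)) = q * slack q n

  -- It pays exactly for the terms q^⌈(n+2)/2⌉ in geometric-slack.
  slack-step : ∀ p n → p * suc p ^ ⌈ suc (suc n) /2⌉ + slack (suc p) (suc n) ≡ suc p * slack (suc p) n
  slack-step p zero = first p
    where
    first : ∀ p → p * (suc p * 1) + suc p * suc (suc p) ≡ suc p * (2 * suc p)
    first = solve-∀
  slack-step p (suc zero) = second p
    where
    second : ∀ p → p * (suc p * (suc p * 1)) + suc p * (2 * suc p) ≡ suc p * (suc p * suc (suc p))
    second = solve-∀
  slack-step p (suc (suc n)) =
    trans (factor p (suc p ^ ⌈ suc (suc n) /2⌉) (slack (suc p) (suc n)))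
          (cong (suc p *_) (slack-step p n))
    where
    factor : ∀ p x s → p * (suc p * x) + suc p * s ≡ suc p * (p * x + s)
    factor = solve-∀

module WordSums (q : ℕ) where

  open Sums

  Σw : ℕ → (Word q → ℕ) → ℕ
  Σw n f = Σ⟨ words q n ⟩ f

  ΣA : (Fin q → ℕ) → ℕ
  ΣA g = Σ⟨ allFin q ⟩ g

  ΣA-const : ∀ c → ΣA (λ _ → c) ≡ q * c
  ΣA-const c = trans (Σ-const (allFin q) c) (trans (cong (c *_) (length-tabulate (λ x → x))) (*-comm c q))

  Σw-cons : ∀ n f → Σw (suc n) f ≡ Σw n (λ w → ΣA (λ a → f (a ∷ w)))
  Σw-cons n f = trans (Σ-concatMap (words q n) _ f) (Σ-cong (words q n) (λ w → Σ-map (allFin q) (_∷ w) f))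

  Σw-ignoring-letter : ∀ n f → Σw n (λ w → ΣA (λ _ → f w)) ≡ q * Σw n f
  Σw-ignoring-letter n f = trans (Σ-cong (words q n) (λ w → ΣA-const (f w))) (Σ-* (words q n) q f)

  Σw-const : ∀ n c → Σw n (λ _ → c) ≡ c * q ^ n
  Σw-const zero    c = trans (+-identityʳ c) (sym (*-identityʳ c))
  Σw-const (suc n) c = begin
      Σw (suc n) (λ _ → c)
    ≡⟨ Σw-cons n (λ _ → c) ⟩
      Σw n (λ _ → ΣA (λ _ → c))
    ≡⟨ Σw-ignoring-letter n (λ _ → c) ⟩
      q * Σw n (λ _ → c)
    ≡⟨ cong (q *_) (Σw-const n c) ⟩
      q * (c * q ^ n)
    ≡⟨ *-comm q (c * q ^ n) ⟩
      c * q ^ n * q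
    ≡⟨ *-assoc c (q ^ n) q ⟩
      c * (q ^ n * q)
    ≡⟨ cong (c *_) (*-comm (q ^ n) q) ⟩
      c * q ^ suc n
    ∎
    where open ≡-Reasoning

  Σw-snoc : ∀ n f → Σw (suc n) f ≡ Σw n (λ u → ΣA (λ a → f (u ++ [ a ])))
  Σw-snoc zero    f = Σw-cons zero f
  Σw-snoc (suc n) f = begin
      Σw (suc (suc n)) f
    ≡⟨ Σw-cons (suc n) f ⟩
      Σw (suc n) (λ w → ΣA (λ b → f (b ∷ w)))
    ≡⟨ Σw-snoc n _ ⟩
      Σw n (λ u → ΣA (λ a → ΣA (λ b → f (b ∷ u ++ [ a ]))))
    ≡⟨ Σ-cong (words q n) (λ u → Σ-swap (allFin q) (allFin q) (λ a b → f (b ∷ u ++ [ a ]))) ⟩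
      Σw n (λ u → ΣA (λ b → ΣA (λ a → f (b ∷ u ++ [ a ]))))
    ≡⟨ sym (Σw-cons n _) ⟩
      Σw (suc n) (λ u → ΣA (λ a → f (u ++ [ a ])))
    ∎
    where open ≡-Reasoning

module Palindromes (q : ℕ) where

  open Sums
  open Counting
  open WordSums q
  open Pigeonhole

  palindrome-interior : ∀ (a : Fin q) u b → IsPalindrome (a ∷ u ++ [ b ]) → b ≡ a × IsPalindrome u
  palindrome-interior a u b pal = proj₁ heads , proj₁ (∷ʳ-injective (reverse u) u (proj₂ heads))
    where
    reversed : reverse (a ∷ u ++ [ b ]) ≡ b ∷ (reverse u ++ [ a ])
    reversed = trans (unfold-reverse a (u ++ [ b ])) (cong (_∷ʳ a) (reverse-++ u [ b ]))
    heads = ∷-injective (trans (sym reversed) pal)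

  palCount : ℕ → ℕ
  palCount m = Σw m (𝟙 isPalindrome?)

  palCount≤q^m : ∀ m → palCount m ≤ q ^ m
  palCount≤q^m m = ≤-trans (Σ-mono (words q m) (𝟙≤1 isPalindrome?))
                           (≤-reflexive (trans (Σw-const m 1) (*-identityˡ (q ^ m))))

  -- A palindrome of length m + 2 is determined by its first letter and its interior.
  palCount-step : ∀ m → palCount (suc (suc m)) ≤ q * palCount m
  palCount-step m = begin
      palCount (suc (suc m))
    ≡⟨ Σw-cons (suc m) pal ⟩
      Σw (suc m) (λ v → ΣA (λ a → pal (a ∷ v)))
    ≡⟨ Σw-snoc m _ ⟩
      Σw m (λ u → ΣA (λ b → ΣA (λ a → pal (a ∷ u ++ [ b ]))))
    ≡⟨ Σ-cong (words q m) (λ u → Σ-swap (allFin q) (allFin q) (λ b a → pal (a ∷ u ++ [ b ]))) ⟩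
      Σw m (λ u → ΣA (λ a → ΣA (λ b → pal (a ∷ u ++ [ b ]))))
    ≤⟨ Σ-mono (words q m) (λ u → Σ-mono (allFin q) (λ a → last-letter-forced a u)) ⟩
      Σw m (λ u → ΣA (λ _ → pal u))
    ≡⟨ Σw-ignoring-letter m pal ⟩
      q * palCount m
    ∎
    where
    open ≤-Reasoning
    pal = 𝟙 isPalindrome?
    last-letter-forced : ∀ a u → ΣA (λ b → pal (a ∷ u ++ [ b ])) ≤ pal u
    last-letter-forced a u = ≤-trans
      (Σ-supported Fin._≟_ a (allFin⁺ q)
        (λ b b≢a → 𝟙-no isPalindrome? (λ p → b≢a (proj₁ (palindrome-interior a u b p)))))
      (𝟙-mono isPalindrome? isPalindrome? (λ p → proj₂ (palindrome-interior a u a p)))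

  palCount-bound : ∀ m → palCount m ≤ q ^ ⌈ m /2⌉
  palCount-bound zero          = palCount≤q^m 0
  palCount-bound (suc zero)    = palCount≤q^m 1
  palCount-bound (suc (suc m)) = ≤-trans (palCount-step m) (*-monoʳ-≤ q (palCount-bound m))

  -- Palindromes of length at least 2, the ones that need not be among the
  -- q + 1 words of length ≤ 1.
  LongPal : Pred (Word q) 0ℓ
  LongPal w = 2 ≤ length w × IsPalindrome w

  longPal? : Decidable LongPal
  longPal? w = (2 ≤? length w) ×-dec isPalindrome? w

  prefixPals factorPals : Word q → ℕ
  prefixPals w = count longPal? (nePrefixes w)
  factorPals w = count longPal? (factors w)

  prefixTotal factorTotal : ℕ → ℕ
  prefixTotal n = Σw n prefixPals
  factorTotal n = Σw n factorPals

  nePrefixes-snoc : ∀ (u : Word q) a → nePrefixes (u ++ [ a ]) ≡ nePrefixes u ++ [ u ++ [ a ] ]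
  nePrefixes-snoc []      a = refl
  nePrefixes-snoc (x ∷ u) a = trans
    (cong (λ ps → [ x ] ∷ map (x ∷_) ps) (nePrefixes-snoc u a))
    (cong ([ x ] ∷_) (map-++ (x ∷_) (nePrefixes u) [ u ++ [ a ] ]))

  prefixPals-snoc : ∀ (u : Word q) a → prefixPals (u ++ [ a ]) ≡ prefixPals u + 𝟙 longPal? (u ++ [ a ])
  prefixPals-snoc u a = trans (cong (count longPal?) (nePrefixes-snoc u a))
                              (count-++ longPal? (nePrefixes u) _)

  prefixTotal-one : prefixTotal 1 ≡ 0
  prefixTotal-one = trans (Σw-cons 0 prefixPals)
                          (trans (+-identityʳ _) (trans (ΣA-const 0) (*-zeroʳ q)))

  -- Grouping occurrences by the last letter:  E(n+1) ≤ q·E(n) + q^⌈(n+1)/2⌉.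
  prefixTotal-step : ∀ n → prefixTotal (suc n) ≤ q * prefixTotal n + q ^ ⌈ suc n /2⌉
  prefixTotal-step n = begin
      prefixTotal (suc n)
    ≡⟨ Σw-snoc n prefixPals ⟩
      Σw n (λ u → ΣA (λ a → prefixPals (u ++ [ a ])))
    ≡⟨ Σ-cong (words q n) (λ u → trans (Σ-cong (allFin q) (prefixPals-snoc u)) (Σ-+ (allFin q) _ _)) ⟩
      Σw n (λ u → ΣA (λ _ → prefixPals u) + ΣA (λ a → 𝟙 longPal? (u ++ [ a ])))
    ≡⟨ Σ-+ (words q n) _ _ ⟩
      Σw n (λ u → ΣA (λ _ → prefixPals u)) + Σw n (λ u → ΣA (λ a → 𝟙 longPal? (u ++ [ a ])))
    ≡⟨ cong₂ _+_ (Σw-ignoring-letter n prefixPals) (sym (Σw-snoc n (𝟙 longPal?))) ⟩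
      q * prefixTotal n + Σw (suc n) (𝟙 longPal?)
    ≤⟨ +-monoʳ-≤ (q * prefixTotal n) (Σ-mono (words q (suc n)) (λ w → 𝟙-mono longPal? isPalindrome? {w} {w} proj₂)) ⟩
      q * prefixTotal n + palCount (suc n)
    ≤⟨ +-monoʳ-≤ (q * prefixTotal n) (palCount-bound (suc n)) ⟩
      q * prefixTotal n + q ^ ⌈ suc n /2⌉
    ∎
    where open ≤-Reasoning

  -- Grouping occurrences by the first letter:  O(n+1) = E(n+1) + q·O(n).
  factorTotal-step : ∀ n → factorTotal (suc n) ≡ prefixTotal (suc n) + q * factorTotal n
  factorTotal-step n = begin
      factorTotal (suc n)
    ≡⟨ Σw-cons n factorPals ⟩
      Σw n (λ w → ΣA (λ a → factorPals (a ∷ w)))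
    ≡⟨ Σ-cong (words q n) (λ w → trans (Σ-cong (allFin q) (λ a → count-++ longPal? (nePrefixes (a ∷ w)) (factors w)))
                                        (Σ-+ (allFin q) (λ a → prefixPals (a ∷ w)) (λ _ → factorPals w))) ⟩
      Σw n (λ w → ΣA (λ a → prefixPals (a ∷ w)) + ΣA (λ _ → factorPals w))
    ≡⟨ Σ-+ (words q n) _ _ ⟩
      Σw n (λ w → ΣA (λ a → prefixPals (a ∷ w))) + Σw n (λ w → ΣA (λ _ → factorPals w))
    ≡⟨ cong₂ _+_ (sym (Σw-cons n prefixPals)) (Σw-ignoring-letter n factorPals) ⟩
      prefixTotal (suc n) + q * factorTotal n
    ∎
    where open ≡-Reasoning

  shortWords : List (Word q)
  shortWords = [] ∷ map [_] (allFin q)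

  short∈shortWords : ∀ u → ¬ (2 ≤ length u) → u ∈ shortWords
  short∈shortWords []          _     = here refl
  short∈shortWords (a ∷ [])    _     = there (∈-map⁺ [_] (∈-allFin a))
  short∈shortWords (a ∷ b ∷ u) short = ⊥-elim (short (s≤s (s≤s z≤n)))

  length-shortWords : length shortWords ≡ suc q
  length-shortWords = cong suc (trans (length-map [_] (allFin q)) (length-tabulate (λ x → x)))

  -- Each distinct palindrome of w is short or occurs in w as a long palindrome:
  -- P(w) ≤ q + 1 + O(w).
  distinctPals-bound : ∀ w → P w ≤ suc q + factorPals w
  distinctPals-bound w = begin
      P w
    ≤⟨ unique⊆⇒length≤ (deduplicate-! _≟W_ pals) distinct⊆ ⟩
      length (shortWords ++ filter longPal? (factors w))
    ≡⟨ length-++ shortWords ⟩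
      length shortWords + factorPals w
    ≡⟨ cong (_+ factorPals w) length-shortWords ⟩
      suc q + factorPals w
    ∎
    where
    open ≤-Reasoning
    pals = filter isPalindrome? (factors w)
    distinct⊆ : deduplicate _≟W_ pals ⊆ shortWords ++ filter longPal? (factors w)
    distinct⊆ {y} y∈ with ∈-filter⁻ isPalindrome? {xs = factors w} (∈-deduplicate⁻ _≟W_ pals y∈) | 2 ≤? length y
    ... | y∈factors , pal-y | yes long  = ∈-++⁺ʳ shortWords (∈-filter⁺ longPal? {xs = factors w} y∈factors (long , pal-y))
    ... | _                 | no  short = ∈-++⁺ˡ (short∈shortWords y short)

  S-bound : ∀ n → S q n ≤ suc q * q ^ n + factorTotal n
  S-bound n = begin
      S q n
    ≤⟨ Σ-mono (words q n) distinctPals-bound ⟩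
      Σw n (λ w → suc q + factorPals w)
    ≡⟨ Σ-+ (words q n) (λ _ → suc q) factorPals ⟩
      Σw n (λ _ → suc q) + factorTotal n
    ≡⟨ cong (_+ factorTotal n) (Σw-const n (suc q)) ⟩
      suc q * q ^ n + factorTotal n
    ∎
    where open ≤-Reasoning

module Estimates (p : ℕ) where

  open Recurrences
  open Palindromes (suc p)

  -- Summing the palindrome bounds as a geometric series: (q-1)·E(n) ≤ 2·q^n.
  prefixTotal-bound : ∀ n → p * prefixTotal (suc n) ≤ 2 * suc p ^ suc n
  prefixTotal-bound n = begin
      p * prefixTotal (suc n)
    ≤⟨ m≤m+n (p * prefixTotal (suc n)) (slack (suc p) n) ⟩
      p * prefixTotal (suc n) + slack (suc p) n
    ≤⟨ geometric-slack p (λ m → prefixTotal (suc m)) (λ m → suc p ^ ⌈ suc (suc m) /2⌉) (slack (suc p))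
         (λ m → prefixTotal-step (suc m)) (λ m → ≤-reflexive (slack-step p m)) n ⟩
      (p * prefixTotal 1 + 2 * suc p) * suc p ^ n
    ≡⟨ cong (λ e → (p * e + 2 * suc p) * suc p ^ n) prefixTotal-one ⟩
      (p * 0 + 2 * suc p) * suc p ^ n
    ≡⟨ simplify p (suc p ^ n) ⟩
      2 * suc p ^ suc n
    ∎
    where
    open ≤-Reasoning
    simplify : ∀ p x → (p * 0 + 2 * suc p) * x ≡ 2 * (suc p * x)
    simplify = solve-∀

  factorTotal-bound : ∀ n → p * factorTotal n ≤ 2 * (n * suc p ^ n)
  factorTotal-bound = linear-accumulation (suc p) p 2 factorTotal prefixTotal refl
    (λ n → ≤-reflexive (factorTotal-step n)) prefixTotal-bound

-- For q ≥ 4 and n ≥ 12(q+1):  12·S(n) ≤ 12(q+1)·q^n + 4·(3·O(n)) ≤ n·q^n + 8·n·q^n,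
-- i.e. M_q(n)/n ≤ 3/4.
mainTheorem5 : (q : ℕ) → 4 ≤ q →
    Σ ℕ λ a → Σ ℕ λ b → Σ ℕ λ N →
    a < b × ((n : ℕ) → N ≤ n → b * S q n ≤ a * (n * q ^ n))
mainTheorem5 (suc p) (s≤s 3≤p) = 9 , 12 , 12 * suc q , m<m+n 9 z<s , density-bound
  where
  q = suc p
  open Palindromes q using (factorTotal; S-bound)
  open Estimates p using (factorTotal-bound)
  open ≤-Reasoning

  density-bound : ∀ n → 12 * suc q ≤ n → 12 * S q n ≤ 9 * (n * q ^ n)
  density-bound n N≤n = begin
      12 * S q n
    ≤⟨ *-monoʳ-≤ 12 (S-bound n) ⟩
      12 * (suc q * q ^ n + factorTotal n)
    ≡⟨ split (suc q) (q ^ n) (factorTotal n) ⟩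
      12 * suc q * q ^ n + 4 * (3 * factorTotal n)
    ≤⟨ +-mono-≤ (*-monoˡ-≤ (q ^ n) N≤n)
                (*-monoʳ-≤ 4 (≤-trans (*-monoˡ-≤ (factorTotal n) 3≤p) (factorTotal-bound n))) ⟩
      n * q ^ n + 4 * (2 * (n * q ^ n))
    ≡⟨ collect (n * q ^ n) ⟩
      9 * (n * q ^ n)
    ∎
    where
    split : ∀ k x o → 12 * (k * x + o) ≡ 12 * k * x + 4 * (3 * o)
    split = solve-∀
    collect : ∀ y → y + 4 * (2 * y) ≡ 9 * y
    collect = solve-∀
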